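{- Let $\mathcal{V}$ be a category with finite products, $(T,\delta,\epsilon)$ a comonad on $\mathcal{V}$ and $l:TT\Rightarrow TT$ a self-distributive law for it, and let $T_T:\mathcal{V}_T\to\mathcal{V}_T$ be the lifted endofunctor on the co-Kleisli category. If $T$ preserves binary products, then so does $T_T$; moreover, if $T$ preserves finite products, then so does $T_T$.
   Context: A distributive law for the comonad $T$ over itself is a natural transformation $l:TT\Rightarrow TT$ with $lT\circ Tl\circ\delta T=T\delta\circ l$, $T\epsilon\circ l=\epsilon T$, $Tl\circ lT\circ T\delta=\delta T\circ l$, $\epsilon T\circ l=T\epsilon$; it is self-distributive if $Tl\circ lT\circ Tl=lT\circ Tl\circ lT$. The co-Kleisli category $\mathcal{V}_T$ has morphisms $A\to B$ the morphisms $TA\to B$ of $\mathcal{V}$, composition $g\circ_T f=g\circ Tf\circ\delta$, and finite products given by those of $\mathcal{V}$. The lifted functor is $T_TA=TA$ and, for $f:TA\to B$, $T_T f=Tf\circ l_A:T^2A\to TB$. A functor preserves binary (finite) products if the canonical comparison maps are isomorphisms. -}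

module Defs where

open import Level using (Level; _⊔_) renaming (suc to lsuc)
open import Data.Product using (Σ; _×_; _,_)
open import Relation.Binary.PropositionalEquality
open ≡-Reasoning

record Category (o ℓ : Level) : Set (lsuc (o ⊔ ℓ)) where
  infixr 9 _∘_
  field
    Obj : Set o
    Hom : Obj → Obj → Set ℓ
    id  : ∀ {A} → Hom A A
    _∘_ : ∀ {A B C} → Hom B C → Hom A B → Hom A C
    identityˡ : ∀ {A B} {f : Hom A B} → id ∘ f ≡ f
    identityʳ : ∀ {A B} {f : Hom A B} → f ∘ id ≡ f
    assoc : ∀ {A B C D} {f : Hom A B} {g : Hom B C} {h : Hom C D} →
            (h ∘ g) ∘ f ≡ h ∘ (g ∘ f)

record Functor {o ℓ o′ ℓ′ : Level} (C : Category o ℓ) (D : Category o′ ℓ′)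
       : Set (o ⊔ ℓ ⊔ o′ ⊔ ℓ′) where
  private
    module C = Category C
    module D = Category D
  field
    F₀ : C.Obj → D.Obj
    F₁ : ∀ {A B} → C.Hom A B → D.Hom (F₀ A) (F₀ B)
    identity : ∀ {A} → F₁ (C.id {A}) ≡ D.id
    homomorphism : ∀ {A B C′} {f : C.Hom A B} {g : C.Hom B C′} →
                   F₁ (g C.∘ f) ≡ F₁ g D.∘ F₁ f

record IsIso {o ℓ : Level} (C : Category o ℓ) {A B : Category.Obj C}
             (f : Category.Hom C A B) : Set ℓ where
  open Category C
  field
    inv : Hom B A
    isoˡ : inv ∘ f ≡ id
    isoʳ : f ∘ inv ≡ id

record Terminal {o ℓ : Level} (C : Category o ℓ) : Set (o ⊔ ℓ) where
  open Category C
  field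
    ⊤ : Obj
    ! : ∀ {A} → Hom A ⊤
    !-unique : ∀ {A} (f : Hom A ⊤) → f ≡ !

record BinaryProducts {o ℓ : Level} (C : Category o ℓ) : Set (o ⊔ ℓ) where
  open Category C
  infixr 7 _×ₒ_
  field
    _×ₒ_ : Obj → Obj → Obj
    π₁ : ∀ {A B} → Hom (A ×ₒ B) A
    π₂ : ∀ {A B} → Hom (A ×ₒ B) B
    ⟨_,_⟩ : ∀ {C′ A B} → Hom C′ A → Hom C′ B → Hom C′ (A ×ₒ B)
    project₁ : ∀ {C′ A B} {f : Hom C′ A} {g : Hom C′ B} → π₁ ∘ ⟨ f , g ⟩ ≡ f
    project₂ : ∀ {C′ A B} {f : Hom C′ A} {g : Hom C′ B} → π₂ ∘ ⟨ f , g ⟩ ≡ g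
    unique : ∀ {C′ A B} {f : Hom C′ A} {g : Hom C′ B} {h : Hom C′ (A ×ₒ B)} →
             π₁ ∘ h ≡ f → π₂ ∘ h ≡ g → h ≡ ⟨ f , g ⟩

record FiniteProducts {o ℓ : Level} (C : Category o ℓ) : Set (o ⊔ ℓ) where
  field
    terminal : Terminal C
    binary   : BinaryProducts C

PreservesBinaryProducts : ∀ {o ℓ} {C : Category o ℓ} →
  BinaryProducts C → Functor C C → Set (o ⊔ ℓ)
PreservesBinaryProducts {C = C} P F =
  ∀ A B → IsIso C {F₀ (A ×ₒ B)} {F₀ A ×ₒ F₀ B} ⟨ F₁ (π₁ {A} {B}) , F₁ (π₂ {A} {B}) ⟩
  where open BinaryProducts P
        open Functor F

PreservesTerminal : ∀ {o ℓ} {C : Category o ℓ} →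
  Terminal C → Functor C C → Set ℓ
PreservesTerminal {C = C} T F = IsIso C {Functor.F₀ F ⊤} {⊤} !
  where open Terminal T

PreservesFiniteProducts : ∀ {o ℓ} {C : Category o ℓ} →
  FiniteProducts C → Functor C C → Set (o ⊔ ℓ)
PreservesFiniteProducts FP F =
  PreservesTerminal (FiniteProducts.terminal FP) F ×
  PreservesBinaryProducts (FiniteProducts.binary FP) F

record Comonad {o ℓ : Level} (C : Category o ℓ) : Set (o ⊔ ℓ) where
  open Category C
  field
    F : Functor C C
  open Functor F public renaming (F₀ to T₀; F₁ to T₁)
  field
    ε : ∀ A → Hom (T₀ A) A
    δ : ∀ A → Hom (T₀ A) (T₀ (T₀ A))
    ε-natural : ∀ {A B} (f : Hom A B) → ε B ∘ T₁ f ≡ f ∘ ε A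
    δ-natural : ∀ {A B} (f : Hom A B) → δ B ∘ T₁ f ≡ T₁ (T₁ f) ∘ δ A
    εT∘δ : ∀ A → ε (T₀ A) ∘ δ A ≡ id
    Tε∘δ : ∀ A → T₁ (ε A) ∘ δ A ≡ id
    δT∘δ : ∀ A → δ (T₀ A) ∘ δ A ≡ T₁ (δ A) ∘ δ A

record DistributiveLaw {o ℓ : Level} {C : Category o ℓ} (W : Comonad C)
       : Set (o ⊔ ℓ) where
  open Category C
  open Comonad W
  field
    l : ∀ A → Hom (T₀ (T₀ A)) (T₀ (T₀ A))
    l-natural : ∀ {A B} (f : Hom A B) → l B ∘ T₁ (T₁ f) ≡ T₁ (T₁ f) ∘ l A
    law-δ₁ : ∀ A → l (T₀ A) ∘ T₁ (l A) ∘ δ (T₀ A) ≡ T₁ (δ A) ∘ l A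
    law-ε₁ : ∀ A → T₁ (ε A) ∘ l A ≡ ε (T₀ A)
    law-δ₂ : ∀ A → T₁ (l A) ∘ l (T₀ A) ∘ T₁ (δ A) ≡ δ (T₀ A) ∘ l A
    law-ε₂ : ∀ A → ε (T₀ A) ∘ l A ≡ T₁ (ε A)

SelfDistributive : ∀ {o ℓ} {C : Category o ℓ} {W : Comonad C} →
  DistributiveLaw W → Set (o ⊔ ℓ)
SelfDistributive {C = C} {W} D =
  ∀ A → T₁ (l A) ∘ l (T₀ A) ∘ T₁ (l A) ≡ l (T₀ A) ∘ T₁ (l A) ∘ l (T₀ A)
  where open Category C
        open Comonad W
        open DistributiveLaw D

module _ {o ℓ : Level} {C : Category o ℓ} (W : Comonad C) where
  open Category C
  open Comonad W

  private
    key : ∀ {A B X} (p : Hom B X) (h : Hom (T₀ A) B) →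
          (p ∘ ε B) ∘ T₁ h ∘ δ A ≡ p ∘ h
    key {A} {B} p h = begin
      (p ∘ ε B) ∘ T₁ h ∘ δ A   ≡⟨ assoc ⟩
      p ∘ ε B ∘ T₁ h ∘ δ A     ≡⟨ cong (p ∘_) (sym assoc) ⟩
      p ∘ (ε B ∘ T₁ h) ∘ δ A   ≡⟨ cong (λ z → p ∘ z ∘ δ A) (ε-natural h) ⟩
      p ∘ (h ∘ ε (T₀ A)) ∘ δ A ≡⟨ cong (p ∘_) assoc ⟩
      p ∘ h ∘ ε (T₀ A) ∘ δ A   ≡⟨ cong (λ z → p ∘ h ∘ z) (εT∘δ A) ⟩
      p ∘ h ∘ id               ≡⟨ cong (p ∘_) identityʳ ⟩
      p ∘ h ∎

  CoKleisli : Category o ℓ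
  CoKleisli = record
    { Obj = Obj
    ; Hom = λ A B → Hom (T₀ A) B
    ; id = λ {A} → ε A
    ; _∘_ = λ {A} g f → g ∘ T₁ f ∘ δ A
    ; identityˡ = λ {A} {B} {f} → trans (sym assoc) (trans (cong (_∘ δ A) (ε-natural f))
                    (trans assoc (trans (cong (f ∘_) (εT∘δ A)) identityʳ)))
    ; identityʳ = λ {A} {B} {f} → trans (cong (f ∘_) (Tε∘δ A)) identityʳ
    ; assoc = λ {A} {B} {C′} {D} {f} {g} {h} → begin
        (h ∘ T₁ g ∘ δ B) ∘ T₁ f ∘ δ A              ≡⟨ assoc ⟩
        h ∘ (T₁ g ∘ δ B) ∘ T₁ f ∘ δ A              ≡⟨ cong (h ∘_) assoc ⟩
        h ∘ T₁ g ∘ δ B ∘ T₁ f ∘ δ A                ≡⟨ cong (λ z → h ∘ T₁ g ∘ z) (sym assoc) ⟩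
        h ∘ T₁ g ∘ (δ B ∘ T₁ f) ∘ δ A              ≡⟨ cong (λ z → h ∘ T₁ g ∘ z ∘ δ A) (δ-natural f) ⟩
        h ∘ T₁ g ∘ (T₁ (T₁ f) ∘ δ (T₀ A)) ∘ δ A    ≡⟨ cong (λ z → h ∘ T₁ g ∘ z) assoc ⟩
        h ∘ T₁ g ∘ T₁ (T₁ f) ∘ δ (T₀ A) ∘ δ A      ≡⟨ cong (λ z → h ∘ T₁ g ∘ T₁ (T₁ f) ∘ z) (δT∘δ A) ⟩
        h ∘ T₁ g ∘ T₁ (T₁ f) ∘ T₁ (δ A) ∘ δ A      ≡⟨ cong (λ z → h ∘ T₁ g ∘ z) (sym assoc) ⟩
        h ∘ T₁ g ∘ (T₁ (T₁ f) ∘ T₁ (δ A)) ∘ δ A    ≡⟨ cong (λ z → h ∘ T₁ g ∘ z ∘ δ A) (sym homomorphism) ⟩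
        h ∘ T₁ g ∘ T₁ (T₁ f ∘ δ A) ∘ δ A           ≡⟨ cong (h ∘_) (sym assoc) ⟩
        h ∘ (T₁ g ∘ T₁ (T₁ f ∘ δ A)) ∘ δ A         ≡⟨ cong (λ z → h ∘ z ∘ δ A) (sym homomorphism) ⟩
        h ∘ T₁ (g ∘ T₁ f ∘ δ A) ∘ δ A ∎
    }

  CoKleisliBinaryProducts : BinaryProducts C → BinaryProducts CoKleisli
  CoKleisliBinaryProducts P = record
    { _×ₒ_ = _×ₒ_
    ; π₁ = λ {A} {B} → π₁ ∘ ε (A ×ₒ B)
    ; π₂ = λ {A} {B} → π₂ ∘ ε (A ×ₒ B)
    ; ⟨_,_⟩ = ⟨_,_⟩
    ; project₁ = λ {_} {_} {_} {f} {g} → trans (key π₁ ⟨ f , g ⟩) project₁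
    ; project₂ = λ {_} {_} {_} {f} {g} → trans (key π₂ ⟨ f , g ⟩) project₂
    ; unique = λ {_} {_} {_} {f} {g} {h} p q →
        unique (trans (sym (key π₁ h)) p) (trans (sym (key π₂ h)) q)
    }
    where open BinaryProducts P

  CoKleisliTerminal : Terminal C → Terminal CoKleisli
  CoKleisliTerminal t = record
    { ⊤ = ⊤ ; ! = ! ; !-unique = !-unique }
    where open Terminal t

  CoKleisliFiniteProducts : FiniteProducts C → FiniteProducts CoKleisli
  CoKleisliFiniteProducts FP = record
    { terminal = CoKleisliTerminal (FiniteProducts.terminal FP)
    ; binary = CoKleisliBinaryProducts (FiniteProducts.binary FP) }

module _ {o ℓ : Level} {C : Category o ℓ} {W : Comonad C} where
  open Category C
  open Comonad W

  Lifted : DistributiveLaw W → Functor (CoKleisli W) (CoKleisli W)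
  Lifted D = record
    { F₀ = T₀
    ; F₁ = λ {A} f → T₁ f ∘ l A
    ; identity = λ {A} → law-ε₁ A
    ; homomorphism = λ {A} {B} {C′} {f} {g} → begin
        T₁ (g ∘ T₁ f ∘ δ A) ∘ l A                            ≡⟨ cong (_∘ l A) homomorphism ⟩
        (T₁ g ∘ T₁ (T₁ f ∘ δ A)) ∘ l A                       ≡⟨ cong (λ z → (T₁ g ∘ z) ∘ l A) homomorphism ⟩
        (T₁ g ∘ T₁ (T₁ f) ∘ T₁ (δ A)) ∘ l A                  ≡⟨ assoc ⟩
        T₁ g ∘ (T₁ (T₁ f) ∘ T₁ (δ A)) ∘ l A                  ≡⟨ cong (T₁ g ∘_) assoc ⟩
        T₁ g ∘ T₁ (T₁ f) ∘ T₁ (δ A) ∘ l A                    ≡⟨ cong (λ z → T₁ g ∘ T₁ (T₁ f) ∘ z) (sym (law-δ₁ A)) ⟩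
        T₁ g ∘ T₁ (T₁ f) ∘ l (T₀ A) ∘ T₁ (l A) ∘ δ (T₀ A)    ≡⟨ cong (T₁ g ∘_) (sym assoc) ⟩
        T₁ g ∘ (T₁ (T₁ f) ∘ l (T₀ A)) ∘ T₁ (l A) ∘ δ (T₀ A)  ≡⟨ cong (λ z → T₁ g ∘ z ∘ T₁ (l A) ∘ δ (T₀ A)) (sym (l-natural f)) ⟩
        T₁ g ∘ (l B ∘ T₁ (T₁ f)) ∘ T₁ (l A) ∘ δ (T₀ A)       ≡⟨ cong (T₁ g ∘_) assoc ⟩
        T₁ g ∘ l B ∘ T₁ (T₁ f) ∘ T₁ (l A) ∘ δ (T₀ A)         ≡⟨ cong (λ z → T₁ g ∘ l B ∘ z) (sym assoc) ⟩
        T₁ g ∘ l B ∘ (T₁ (T₁ f) ∘ T₁ (l A)) ∘ δ (T₀ A)       ≡⟨ cong (λ z → T₁ g ∘ l B ∘ z ∘ δ (T₀ A)) (sym homomorphism) ⟩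
        T₁ g ∘ l B ∘ T₁ (T₁ f ∘ l A) ∘ δ (T₀ A)              ≡⟨ sym assoc ⟩
        (T₁ g ∘ l B) ∘ T₁ (T₁ f ∘ l A) ∘ δ (T₀ A) ∎
    }
    where open DistributiveLaw D

module Submission where

open import Defs
open import Level using (Level)
open import Data.Product using (_×_; _,_)
open import Relation.Binary.PropositionalEquality

-- Composing a map of V with ε embeds V into its co-Kleisli category, and this
-- embedding preserves isomorphisms. The lifted functor T_T sends the embedded
-- map p ∘ ε to T p ∘ ε (by Tε ∘ l = εT), so the product comparison maps of T_T
-- are the embeddings of those of T.

module _ {o ℓ : Level} {V : Category o ℓ} where
  open Category V
  open ≡-Reasoning

  module _ (P : BinaryProducts V) where
    open BinaryProducts P

    ⟨⟩-∘ : ∀ {X Y A B} {f : Hom Y A} {g : Hom Y B} {h : Hom X Y} →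
           ⟨ f , g ⟩ ∘ h ≡ ⟨ f ∘ h , g ∘ h ⟩
    ⟨⟩-∘ = unique (trans (sym assoc) (cong (_∘ _) project₁))
                  (trans (sym assoc) (cong (_∘ _) project₂))

  module _ (W : Comonad V) where
    open Comonad W
    private
      module K = Category (CoKleisli W)

    ε-lift-∘ : ∀ {A B X} (p : Hom B X) (h : K.Hom A B) →
               (p ∘ ε B) K.∘ h ≡ p ∘ h
    ε-lift-∘ {A} {B} p h = begin
      (p ∘ ε B) ∘ T₁ h ∘ δ A   ≡⟨ assoc ⟩
      p ∘ ε B ∘ T₁ h ∘ δ A     ≡⟨ cong (p ∘_) (sym assoc) ⟩
      p ∘ (ε B ∘ T₁ h) ∘ δ A   ≡⟨ cong (λ z → p ∘ z ∘ δ A) (ε-natural h) ⟩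
      p ∘ (h ∘ ε (T₀ A)) ∘ δ A ≡⟨ cong (p ∘_) assoc ⟩
      p ∘ h ∘ ε (T₀ A) ∘ δ A   ≡⟨ cong (λ z → p ∘ h ∘ z) (εT∘δ A) ⟩
      p ∘ h ∘ id               ≡⟨ cong (p ∘_) identityʳ ⟩
      p ∘ h ∎

    ε-lift-iso : ∀ {A B} {f : Hom A B} → IsIso V f → IsIso (CoKleisli W) (f ∘ ε A)
    ε-lift-iso {A} {B} {f} iso = record
      { inv  = g ∘ ε B
      ; isoˡ = lift-inverse g f isoˡ
      ; isoʳ = lift-inverse f g isoʳ
      }
      where
        open IsIso iso renaming (inv to g)
        lift-inverse : ∀ {X Y} (u : Hom Y X) (v : Hom X Y) →
                       u ∘ v ≡ id → (u ∘ ε Y) K.∘ (v ∘ ε X) ≡ ε X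
        lift-inverse u v u∘v≡id = begin
          (u ∘ ε _) K.∘ (v ∘ ε _) ≡⟨ ε-lift-∘ u (v ∘ ε _) ⟩
          u ∘ v ∘ ε _             ≡⟨ sym assoc ⟩
          (u ∘ v) ∘ ε _           ≡⟨ cong (_∘ ε _) u∘v≡id ⟩
          id ∘ ε _                ≡⟨ identityˡ ⟩
          ε _ ∎

    module _ (D : DistributiveLaw W) where
      open DistributiveLaw D using (l; law-ε₁)

      Lifted-ε-lift : ∀ {A X} (p : Hom A X) →
                      Functor.F₁ (Lifted D) (p ∘ ε A) ≡ T₁ p ∘ ε (T₀ A)
      Lifted-ε-lift {A} p = begin
        T₁ (p ∘ ε A) ∘ l A      ≡⟨ cong (_∘ l A) homomorphism ⟩
        (T₁ p ∘ T₁ (ε A)) ∘ l A ≡⟨ assoc ⟩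
        T₁ p ∘ T₁ (ε A) ∘ l A   ≡⟨ cong (T₁ p ∘_) (law-ε₁ A) ⟩
        T₁ p ∘ ε (T₀ A) ∎

      Lifted-preservesBinaryProducts : (P : BinaryProducts V) →
        PreservesBinaryProducts P F →
        PreservesBinaryProducts (CoKleisliBinaryProducts W P) (Lifted D)
      Lifted-preservesBinaryProducts P pres A B =
        subst (IsIso (CoKleisli W)) (sym comparison≡lift) (ε-lift-iso (pres A B))
        where
          open BinaryProducts P
          comparison≡lift :
            ⟨ T₁ (π₁ ∘ ε (A ×ₒ B)) ∘ l (A ×ₒ B) , T₁ (π₂ ∘ ε (A ×ₒ B)) ∘ l (A ×ₒ B) ⟩
              ≡ ⟨ T₁ π₁ , T₁ π₂ ⟩ ∘ ε (T₀ (A ×ₒ B))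
          comparison≡lift = begin
            ⟨ T₁ (π₁ ∘ ε _) ∘ l _ , T₁ (π₂ ∘ ε _) ∘ l _ ⟩
              ≡⟨ cong₂ ⟨_,_⟩ (Lifted-ε-lift π₁) (Lifted-ε-lift π₂) ⟩
            ⟨ T₁ π₁ ∘ ε _ , T₁ π₂ ∘ ε _ ⟩
              ≡⟨ sym (⟨⟩-∘ P) ⟩
            ⟨ T₁ π₁ , T₁ π₂ ⟩ ∘ ε _ ∎

      Lifted-preservesTerminal : (t : Terminal V) →
        PreservesTerminal t F →
        PreservesTerminal (CoKleisliTerminal W t) (Lifted D)
      Lifted-preservesTerminal t pres =
        subst (IsIso (CoKleisli W)) (!-unique _) (ε-lift-iso pres)
        where open Terminal t

lemma4p14 : ∀ {o ℓ : Level} (V : Category o ℓ) (FP : FiniteProducts V)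
              (W : Comonad V) (D : DistributiveLaw W) → SelfDistributive D →
              (PreservesBinaryProducts (FiniteProducts.binary FP) (Comonad.F W) →
                 PreservesBinaryProducts
                   (CoKleisliBinaryProducts W (FiniteProducts.binary FP)) (Lifted D))
              × (PreservesFiniteProducts FP (Comonad.F W) →
                 PreservesFiniteProducts (CoKleisliFiniteProducts W FP) (Lifted D))
lemma4p14 V FP W D _ =
    Lifted-preservesBinaryProducts W D binary ,
    λ (presTerminal , presBinary) →
      Lifted-preservesTerminal W D terminal presTerminal ,
      Lifted-preservesBinaryProducts W D binary presBinary
  where open FiniteProducts FP
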